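{- Let $p$ be an odd prime and $Q$ be a primitive matrix of order $n$. If some entry of $Q$ is nonintegral, then after suitable row permutations and column permutations, $Q$ takes the quasi-diagonal form $\mathrm{diag}[Q_0,I]$, where $Q_0$ is a primitive matrix none of whose entries is an integer and $I$ is an identity matrix.
   Context: An orthogonal matrix $Q$ is regular if $Qe=e$, where $e$ is the all-one vector. The level of a rational matrix $Q$ is the smallest positive integer $k$ such that $kQ$ is integral. For an odd prime $p$, a primitive matrix is a regular rational orthogonal matrix $Q$ of level $p$ such that $pQ$ has rank $1$ over $\mathbb{F}_p=\mathbb{Z}/p\mathbb{Z}$. -}

module Defs where

open import Data.Nat as ℕ using (ℕ; zero; suc; _≤_)
open import Data.Nat.Primality using (Prime)
open import Data.Integer as ℤ using (ℤ; +_)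
open import Data.Integer.Divisibility using () renaming (_∣_ to _∣ℤ_)
open import Data.Rational using (ℚ; _+_; _*_; 0ℚ; 1ℚ; _/_; ↥_; ↧ₙ_)
open import Data.Fin using (Fin; zero; suc; splitAt)
open import Data.Fin.Properties using (_≟_)
open import Data.Sum using (inj₁; inj₂)
open import Data.Product using (∃; Σ; _×_; _,_)
open import Relation.Nullary using (¬_; yes; no)
open import Relation.Binary.PropositionalEquality using (_≡_)

Matrix : ℕ → Set
Matrix n = Fin n → Fin n → ℚ

Σℚ : (n : ℕ) → (Fin n → ℚ) → ℚ
Σℚ zero    f = 0ℚ
Σℚ (suc n) f = f zero + Σℚ n (λ i → f (suc i))

I : (n : ℕ) → Matrix n
I n i j with i ≟ j
... | yes _ = 1ℚ
... | no  _ = 0ℚ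

ℕ→ℚ : ℕ → ℚ
ℕ→ℚ k = + k / 1

scale : ∀ {n} → ℕ → Matrix n → Matrix n
scale k Q i j = ℕ→ℚ k * Q i j

IsIntegral : ℚ → Set
IsIntegral q = ↧ₙ q ≡ 1

IntegralMatrix : ∀ {n} → Matrix n → Set
IntegralMatrix Q = ∀ i j → IsIntegral (Q i j)

Orthogonal : ∀ {n} → Matrix n → Set
Orthogonal {n} Q = ∀ i j → Σℚ n (λ k → Q k i * Q k j) ≡ I n i j

Regular : ∀ {n} → Matrix n → Set
Regular {n} Q = ∀ i → Σℚ n (λ j → Q i j) ≡ 1ℚ

HasLevel : ∀ {n} → Matrix n → ℕ → Set
HasLevel Q ℓ =
  1 ≤ ℓ × IntegralMatrix (scale ℓ Q) ×
  (∀ k → 1 ≤ k → IntegralMatrix (scale k Q) → ℓ ≤ k)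

RankOneModP : ∀ {n} → ℕ → (Fin n → Fin n → ℤ) → Set
RankOneModP {n} p M =
  (∃ λ i → ∃ λ j → ¬ ((+ p) ∣ℤ M i j)) ×
  Σ (Fin n → ℤ) λ u → Σ (Fin n → ℤ) λ v →
    ∀ i j → (+ p) ∣ℤ (M i j ℤ.- u i ℤ.* v j)

-- the integer matrix pQ (entries are the numerators of p·Q i j,
-- which are the values themselves when p·Q is integral)
intMatrix : ∀ {n} → Matrix n → Fin n → Fin n → ℤ
intMatrix Q i j = ↥ (Q i j)

Primitive : ∀ {n} → ℕ → Matrix n → Set
Primitive p Q =
  Regular Q × Orthogonal Q × HasLevel Q p × RankOneModP p (intMatrix (scale p Q))

OddPrime : ℕ → Set
OddPrime p = Prime p × ¬ (p ≡ 2)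

diagWithI : ∀ {m} (k : ℕ) → Matrix m → Matrix (m ℕ.+ k)
diagWithI {m} k A i j with splitAt m i | splitAt m j
... | inj₁ a | inj₁ b = A a b
... | inj₂ a | inj₂ b = I k a b
... | inj₁ _ | inj₂ _ = 0ℚ
... | inj₂ _ | inj₁ _ = 0ℚ

{-# OPTIONS --safe #-}
-- Write pQ ≡ u vᵀ (mod p). As pQ is integral, Q i j is integral iff p divides (pQ) i j, iff
-- p ∣ u i v j; so by Euclid's lemma the non-integral entries of Q fill exactly a rectangle R × C,
-- with R = {i ∣ p ∤ u i} and C = {j ∣ p ∤ v j}.
-- An integral column j ∉ C has norm 1, and a nonzero integral entry already has square ≥ 1, so the
-- column has a single nonzero entry, in its pivot row r j. Orthogonality to the other columns
-- clears the rest of row r j, and regularity makes the entry 1. Pivot rows lie outside R (they vanish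
-- on C). A row outside R vanishes on C (a nonzero integral entry there would force the non-integral
-- entry of its column to be 0), so by regularity it is the pivot row of some column outside C.
-- Thus r is a bijection from the columns outside C onto the rows outside R; listing R and C first
-- gives diag[Q₀, I], and Q₀ inherits regularity, orthogonality, level p and rank one from Q.

module Submission where

open import Defs
open import Data.Nat as ℕ using (ℕ; zero; suc; _+_)
import Data.Nat.Properties as ℕP
import Data.Nat.Divisibility as ℕD
open import Data.Nat.Primality using (Prime; euclidsLemma)
import Data.Nat.Coprimality as Coprimality
open import Data.Integer as ℤ using (ℤ; +_; +[1+_]; -[1+_])
import Data.Integer.Properties as ℤP
open import Data.Integer.Divisibility using (_∣_)
import Data.Integer.Divisibility.Signed as ℤS
open import Data.Rational as ℚ using (ℚ; mkℚ; 0ℚ; 1ℚ; ↥_; ↧ₙ_; _*_; _≤_; 1/_)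
import Data.Rational.Properties as ℚP
open import Data.Fin using (Fin; zero; suc; splitAt; _↑ˡ_; _↑ʳ_)
import Data.Fin.Properties as FinP
open import Data.Fin.Permutation using (↔⇒≡)
open import Data.Vec.Functional using (_∷_)
import Data.Sum as Sum
open import Data.Sum using (_⊎_; inj₁; inj₂; [_,_]′)
import Data.Product as Prod
open import Data.Product using (∃; ∃₂; Σ; _×_; _,_; proj₁; proj₂)
open import Data.Empty using (⊥-elim)
open import Function.Base using (_∘_; id)
open import Function.Bundles using (_↔_; Inverse; Injection; mk⤖)
open import Function.Definitions using (Injective; Surjective)
open import Function.Properties.Bijection using (⤖⇒↔)
open import Function.Properties.Inverse using (↔⇒↣)
open import Function.Construct.Composition using (_↔-∘_)
open import Relation.Nullary using (¬_; yes; no; ¬?)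
open import Relation.Nullary.Decidable using (decidable-stable)
open import Relation.Unary using (Decidable; ∁)
open import Relation.Unary.Properties using (∁?)
open import Relation.Binary.PropositionalEquality
  using (_≡_; _≢_; _≗_; refl; sym; trans; cong; cong₂; subst; module ≡-Reasoning)
import Algebra.Properties.CommutativeMonoid.Sum ℚP.+-0-commutativeMonoid as ℚSum

fromℤ : ℤ → ℚ
fromℤ z = z ℚ./ 1

fromℤ≡mkℚ : ∀ z → fromℤ z ≡ mkℚ z 0 (Coprimality.sym (Coprimality.1-coprimeTo _))
fromℤ≡mkℚ z = ℚP.↥p/↧p≡p (mkℚ z 0 _)

↥-fromℤ : ∀ z → ↥ fromℤ z ≡ z
↥-fromℤ z rewrite fromℤ≡mkℚ z = refl

fromℤ-integral : ∀ z → IsIntegral (fromℤ z)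
fromℤ-integral z rewrite fromℤ≡mkℚ z = refl

fromℤ-* : ∀ a b → fromℤ (a ℤ.* b) ≡ fromℤ a * fromℤ b
fromℤ-* a b rewrite fromℤ≡mkℚ a | fromℤ≡mkℚ b = refl

integral⇒≡fromℤ↥ : ∀ {q} → IsIntegral q → q ≡ fromℤ (↥ q)
integral⇒≡fromℤ↥ {mkℚ z zero c} refl = sym (ℚP.↥p/↧p≡p (mkℚ z 0 c))

isIntegral? : Decidable IsIntegral
isIntegral? q = ↧ₙ q ℕ.≟ 1

integral-scale : ∀ k {q} → IsIntegral q → IsIntegral (ℕ→ℚ k * q)
integral-scale k {q} q-integral =
  subst (λ x → IsIntegral (ℕ→ℚ k * x)) (sym (integral⇒≡fromℤ↥ q-integral))
    (subst IsIntegral (fromℤ-* (+ k) (↥ q)) (fromℤ-integral (+ k ℤ.* ↥ q)))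

*-cancelˡ-≡ : ∀ {c x y} → c ≢ 0ℚ → c * x ≡ c * y → x ≡ y
*-cancelˡ-≡ {c} {x} {y} c≢0 cx≡cy = begin
  x                    ≡⟨ sym (ℚP.*-identityˡ x) ⟩
  1ℚ * x               ≡⟨ cong (_* x) (sym (ℚP.*-inverseˡ c)) ⟩
  (1/ c * c) * x       ≡⟨ ℚP.*-assoc (1/ c) c x ⟩
  1/ c * (c * x)       ≡⟨ cong (1/ c *_) cx≡cy ⟩
  1/ c * (c * y)       ≡⟨ sym (ℚP.*-assoc (1/ c) c y) ⟩
  (1/ c * c) * y       ≡⟨ cong (_* y) (ℚP.*-inverseˡ c) ⟩
  1ℚ * y               ≡⟨ ℚP.*-identityˡ y ⟩
  y                    ∎
  where
  open ≡-Reasoning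
  instance _ = ℚ.≢-nonZero c≢0

x*y≡0⇒x≡0∨y≡0 : ∀ x y → x * y ≡ 0ℚ → x ≡ 0ℚ ⊎ y ≡ 0ℚ
x*y≡0⇒x≡0∨y≡0 x y xy≡0 with x ℚP.≟ 0ℚ
... | yes x≡0 = inj₁ x≡0
... | no  x≢0 = inj₂ (*-cancelˡ-≡ x≢0 (trans xy≡0 (sym (ℚP.*-zeroʳ x))))

x*x≡0⇒x≡0 : ∀ x → x * x ≡ 0ℚ → x ≡ 0ℚ
x*x≡0⇒x≡0 x = Sum.reduce ∘ x*y≡0⇒x≡0∨y≡0 x x

0≤x*x : ∀ x → 0ℚ ≤ x * x
0≤x*x x with ℚP.≤-total 0ℚ x
... | inj₁ 0≤x = ℚP.nonNegative⁻¹ (x * x)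
  {{ℚP.nonNeg*nonNeg⇒nonNeg x {{ℚ.nonNegative 0≤x}} x {{ℚ.nonNegative 0≤x}}}}
... | inj₂ x≤0 = ℚP.nonNegative⁻¹ (x * x)
  {{ℚP.nonPos*nonPos⇒nonPos x {{ℚ.nonPositive x≤0}} x {{ℚ.nonPositive x≤0}}}}

1≤z*z : ∀ z → z ≢ + 0 → + 1 ℤ.≤ z ℤ.* z
1≤z*z (+ zero)   z≢0 = ⊥-elim (z≢0 refl)
1≤z*z +[1+ n ]   _   = ℤ.+≤+ (ℕ.s≤s ℕ.z≤n)
1≤z*z -[1+ n ]   _   = ℤ.+≤+ (ℕ.s≤s ℕ.z≤n)

1≤x*x : ∀ {x} → IsIntegral x → x ≢ 0ℚ → 1ℚ ≤ x * x
1≤x*x {x} x-integral x≢0 =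
  subst (λ y → 1ℚ ≤ y * y) (sym x≡z) (subst (1ℚ ≤_) (fromℤ-* z z) 1≤z²)
  where
  z = ↥ x
  x≡z = integral⇒≡fromℤ↥ x-integral
  1≤z² : 1ℚ ≤ fromℤ (z ℤ.* z)
  1≤z² rewrite fromℤ≡mkℚ (z ℤ.* z) = ℚ.*≤* (subst (+ 1 ℤ.≤_) (sym (ℤP.*-identityʳ _))
    (1≤z*z z (λ z≡0 → x≢0 (trans x≡z (cong fromℤ z≡0)))))

∣m-n∣n⇒∣m : ∀ {d a b} → d ∣ a ℤ.- b → d ∣ b → d ∣ a
∣m-n∣n⇒∣m {d} {a} {b} d∣a-b d∣b =
  ℤS.∣⇒∣ᵤ {d} {a} (ℤS.∣m+n∣n⇒∣m {d} {a} {ℤ.- b} (ℤS.∣ᵤ⇒∣ d∣a-b) (ℤS.∣m⇒∣-m (ℤS.∣ᵤ⇒∣ d∣b)))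

∣m-n∣m⇒∣n : ∀ {d a b} → d ∣ a ℤ.- b → d ∣ a → d ∣ b
∣m-n∣m⇒∣n {d} {a} {b} d∣a-b d∣a = ℤS.∣⇒∣ᵤ {d} {b} (subst (d ℤS.∣_) (ℤP.neg-involutive b)
  (ℤS.∣m⇒∣-m (ℤS.∣m+n∣m⇒∣n {d} {a} {ℤ.- b} (ℤS.∣ᵤ⇒∣ d∣a-b) (ℤS.∣ᵤ⇒∣ d∣a))))

∣m⇒∣m*n : ∀ {d} a b → d ∣ a → d ∣ a ℤ.* b
∣m⇒∣m*n a b d∣a = subst (_ ℕD.∣_) (sym (ℤP.abs-* a b)) (ℕD.∣m⇒∣m*n ℤ.∣ b ∣ d∣a)

∣n⇒∣m*n : ∀ {d} a b → d ∣ b → d ∣ a ℤ.* b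
∣n⇒∣m*n a b d∣b = subst (_ ℕD.∣_) (sym (ℤP.abs-* a b)) (ℕD.∣n⇒∣m*n ℤ.∣ a ∣ d∣b)

euclidsLemmaℤ : ∀ {p} a b → Prime p → + p ∣ a ℤ.* b → + p ∣ a ⊎ + p ∣ b
euclidsLemmaℤ a b p-prime p∣ab =
  euclidsLemma ℤ.∣ a ∣ ℤ.∣ b ∣ p-prime (subst (_ ℕD.∣_) (ℤP.abs-* a b) p∣ab)

integral⇒∣↥-scale : ∀ p {q} → IsIntegral q → + p ∣ ↥ (ℕ→ℚ p * q)
integral⇒∣↥-scale p {q} q-integral =
  subst (λ x → + p ∣ ↥ (ℕ→ℚ p * x)) (sym (integral⇒≡fromℤ↥ q-integral)) p∣p*z
  where
  p∣p*z : + p ∣ ↥ (fromℤ (+ p) * fromℤ (↥ q))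
  p∣p*z rewrite sym (fromℤ-* (+ p) (↥ q)) | ↥-fromℤ (+ p ℤ.* ↥ q) =
    ∣m⇒∣m*n {+ p} (+ p) (↥ q) (ℕD.∣-refl {p})

∣↥-scale⇒integral : ∀ {p q} → p ≢ 0 → IsIntegral (ℕ→ℚ p * q) → + p ∣ ↥ (ℕ→ℚ p * q) → IsIntegral q
∣↥-scale⇒integral {p} {q} p≢0 pq-integral p∣pq with ℤS.∣ᵤ⇒∣ {+ p} {↥ (ℕ→ℚ p * q)} p∣pq
... | ℤS.divides t pq≡t*p = subst IsIntegral (sym q≡t) (fromℤ-integral t)
  where
  open ≡-Reasoning
  p≢0ℚ : fromℤ (+ p) ≢ 0ℚ
  p≢0ℚ p≡0 = p≢0 (ℤP.+-injective (trans (sym (↥-fromℤ (+ p))) (cong ↥_ p≡0)))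
  q≡t : q ≡ fromℤ t
  q≡t = *-cancelˡ-≡ p≢0ℚ (begin
    fromℤ (+ p) * q            ≡⟨ integral⇒≡fromℤ↥ pq-integral ⟩
    fromℤ (↥ (ℕ→ℚ p * q))      ≡⟨ cong fromℤ (trans pq≡t*p (ℤP.*-comm t (+ p))) ⟩
    fromℤ (+ p ℤ.* t)          ≡⟨ fromℤ-* (+ p) t ⟩
    fromℤ (+ p) * fromℤ t      ∎)

Σ-cong : ∀ {n} {f g : Fin n → ℚ} → f ≗ g → Σℚ n f ≡ Σℚ n g
Σ-cong {zero}  f≗g = refl
Σ-cong {suc n} f≗g = cong₂ ℚ._+_ (f≗g zero) (Σ-cong (f≗g ∘ suc))

Σ-zero : ∀ {n} {f : Fin n → ℚ} → (∀ i → f i ≡ 0ℚ) → Σℚ n f ≡ 0ℚ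
Σ-zero {zero}  f≡0 = refl
Σ-zero {suc n} f≡0 = cong₂ ℚ._+_ (f≡0 zero) (Σ-zero (f≡0 ∘ suc))

Σ-single : ∀ {n} {f : Fin n → ℚ} k → (∀ i → i ≢ k → f i ≡ 0ℚ) → Σℚ n f ≡ f k
Σ-single {suc n} {f} zero    f≡0 =
  trans (cong (f zero ℚ.+_) (Σ-zero (λ i → f≡0 (suc i) (λ ())))) (ℚP.+-identityʳ (f zero))
Σ-single {suc n} {f} (suc k) f≡0 =
  trans (cong₂ ℚ._+_ (f≡0 zero (λ ()))
               (Σ-single k (λ i i≢k → f≡0 (suc i) (i≢k ∘ FinP.suc-injective))))
        (ℚP.+-identityˡ (f (suc k)))

Σ≢0⇒∃≢0 : ∀ {n} (f : Fin n → ℚ) → Σℚ n f ≢ 0ℚ → ∃ λ i → f i ≢ 0ℚ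
Σ≢0⇒∃≢0 {n} f Σ≢0 = FinP.¬∀⟶∃¬ n (λ i → f i ≡ 0ℚ) (λ i → f i ℚP.≟ 0ℚ) (Σ≢0 ∘ Σ-zero)

Σ-split : ∀ m k (f : Fin (m + k) → ℚ) → Σℚ (m + k) f ≡ Σℚ m (f ∘ (_↑ˡ k)) ℚ.+ Σℚ k (f ∘ (m ↑ʳ_))
Σ-split zero    k f = sym (ℚP.+-identityˡ _)
Σ-split (suc m) k f =
  trans (cong (f zero ℚ.+_) (Σ-split m k (f ∘ suc))) (sym (ℚP.+-assoc (f zero) _ _))

Σ-↑ˡ : ∀ m {k} {f : Fin (m + k) → ℚ} → (∀ d → f (m ↑ʳ d) ≡ 0ℚ) → Σℚ (m + k) f ≡ Σℚ m (f ∘ (_↑ˡ k))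
Σ-↑ˡ m {k} {f} f↑ʳ≡0 =
  trans (Σ-split m k f) (trans (cong (Σℚ m (f ∘ (_↑ˡ k)) ℚ.+_) (Σ-zero f↑ʳ≡0)) (ℚP.+-identityʳ _))

Σℚ≡sum : ∀ {n} (f : Fin n → ℚ) → Σℚ n f ≡ ℚSum.sum f
Σℚ≡sum {zero}  f = refl
Σℚ≡sum {suc n} f = cong (f zero ℚ.+_) (Σℚ≡sum (f ∘ suc))

Σ-permute : ∀ {m n} (π : Fin m ↔ Fin n) (f : Fin n → ℚ) → Σℚ m (f ∘ Inverse.to π) ≡ Σℚ n f
Σ-permute π f =
  sym (trans (Σℚ≡sum f) (trans (ℚSum.sum-permute f π) (sym (Σℚ≡sum (f ∘ Inverse.to π)))))

x≤x+y : ∀ {x y} → 0ℚ ≤ y → x ≤ x ℚ.+ y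
x≤x+y {x} {y} 0≤y = subst (_≤ x ℚ.+ y) (ℚP.+-identityʳ x) (ℚP.+-monoʳ-≤ x 0≤y)

x≤y+x : ∀ {x y} → 0ℚ ≤ y → x ≤ y ℚ.+ x
x≤y+x {x} {y} 0≤y = subst (x ≤_) (ℚP.+-comm x y) (x≤x+y 0≤y)

Σ-nonneg : ∀ {n} {f : Fin n → ℚ} → (∀ i → 0ℚ ≤ f i) → 0ℚ ≤ Σℚ n f
Σ-nonneg {zero}  f≥0 = ℚP.≤-refl
Σ-nonneg {suc n} f≥0 = ℚP.+-mono-≤ (f≥0 zero) (Σ-nonneg (f≥0 ∘ suc))

term≤Σ : ∀ {n} {f : Fin n → ℚ} → (∀ i → 0ℚ ≤ f i) → ∀ k → f k ≤ Σℚ n f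
term≤Σ {suc n} f≥0 zero    = x≤x+y (Σ-nonneg (f≥0 ∘ suc))
term≤Σ {suc n} f≥0 (suc k) = ℚP.≤-trans (term≤Σ (f≥0 ∘ suc) k) (x≤y+x (f≥0 zero))

two-terms≤Σ : ∀ {n} {f : Fin n → ℚ} → (∀ i → 0ℚ ≤ f i) → ∀ {k l} → k ≢ l → f k ℚ.+ f l ≤ Σℚ n f
two-terms≤Σ {suc n} f≥0 {zero}  {zero}  k≢l = ⊥-elim (k≢l refl)
two-terms≤Σ {suc n} {f} f≥0 {zero}  {suc l} k≢l = ℚP.+-monoʳ-≤ (f zero) (term≤Σ (f≥0 ∘ suc) l)
two-terms≤Σ {suc n} {f} f≥0 {suc k} {zero} k≢l =
  subst (_≤ Σℚ (suc n) f) (ℚP.+-comm (f zero) (f (suc k)))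
    (ℚP.+-monoʳ-≤ (f zero) (term≤Σ (f≥0 ∘ suc) k))
two-terms≤Σ {suc n} f≥0 {suc k} {suc l} k≢l =
  ℚP.≤-trans (two-terms≤Σ (f≥0 ∘ suc) (k≢l ∘ cong suc)) (x≤y+x (f≥0 zero))

nonneg-Σ≡1⇒others≡0 : ∀ {n} {f : Fin n → ℚ} → (∀ i → 0ℚ ≤ f i) → Σℚ n f ≡ 1ℚ →
  ∀ {r} → 1ℚ ≤ f r → ∀ k → k ≢ r → f k ≡ 0ℚ
nonneg-Σ≡1⇒others≡0 {n} {f} f≥0 Σ≡1 {r} 1≤fr k k≢r = ℚP.≤-antisym fk≤0 (f≥0 k)
  where
  fk≤0 : f k ≤ 0ℚ
  fk≤0 = ℚP.≮⇒≥ λ 0<fk → ℚP.<-irrefl refl (ℚP.<-≤-trans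
    (subst (ℚ._< 1ℚ ℚ.+ f k) (ℚP.+-identityʳ 1ℚ) (ℚP.+-mono-≤-< (ℚP.≤-refl {1ℚ}) 0<fk))
    (ℚP.≤-trans (ℚP.+-monoˡ-≤ (f k) 1≤fr)
                (subst (f r ℚ.+ f k ≤_) Σ≡1 (two-terms≤Σ f≥0 (k≢r ∘ sym)))))

I-diag : ∀ n (i : Fin n) → I n i i ≡ 1ℚ
I-diag n i with i FinP.≟ i
... | yes _   = refl
... | no  i≢i = ⊥-elim (i≢i refl)

I-off : ∀ n {i j : Fin n} → i ≢ j → I n i j ≡ 0ℚ
I-off n {i} {j} i≢j with i FinP.≟ j
... | yes i≡j = ⊥-elim (i≢j i≡j)
... | no  _   = refl

I-integral : ∀ n (i j : Fin n) → IsIntegral (I n i j)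
I-integral n i j with i FinP.≟ j
... | yes _ = refl
... | no  _ = refl

I-reindex : ∀ {m n} {f : Fin m → Fin n} → Injective _≡_ _≡_ f → ∀ a b → I n (f a) (f b) ≡ I m a b
I-reindex {m} {n} {f} f-injective a b with a FinP.≟ b
... | yes refl = I-diag n (f a)
... | no  a≢b  = I-off n (a≢b ∘ f-injective)

diagWithI-blocks : ∀ {m} k {A : Matrix m} (G : Fin m ⊎ Fin k → Fin m ⊎ Fin k → ℚ) →
  (∀ a b → G (inj₁ a) (inj₁ b) ≡ A a b) → (∀ a b → G (inj₁ a) (inj₂ b) ≡ 0ℚ) →
  (∀ a b → G (inj₂ a) (inj₁ b) ≡ 0ℚ) → (∀ a b → G (inj₂ a) (inj₂ b) ≡ I k a b) →
  ∀ i j → G (splitAt m i) (splitAt m j) ≡ diagWithI k A i j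
diagWithI-blocks {m} k G G₁₁ G₁₂ G₂₁ G₂₂ i j with splitAt m i | splitAt m j
... | inj₁ a | inj₁ b = G₁₁ a b
... | inj₁ a | inj₂ b = G₁₂ a b
... | inj₂ a | inj₁ b = G₂₁ a b
... | inj₂ a | inj₂ b = G₂₂ a b

diagWithI-↑ˡ-↑ˡ : ∀ {m} k (A : Matrix m) a b → diagWithI k A (a ↑ˡ k) (b ↑ˡ k) ≡ A a b
diagWithI-↑ˡ-↑ˡ {m} k A a b rewrite FinP.splitAt-↑ˡ m a k | FinP.splitAt-↑ˡ m b k = refl

diagWithI-↑ˡ-↑ʳ : ∀ {m} k (A : Matrix m) a d → diagWithI k A (a ↑ˡ k) (m ↑ʳ d) ≡ 0ℚ
diagWithI-↑ˡ-↑ʳ {m} k A a d rewrite FinP.splitAt-↑ˡ m a k | FinP.splitAt-↑ʳ m k d = refl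

diagWithI-↑ʳ-↑ˡ : ∀ {m} k (A : Matrix m) d b → diagWithI k A (m ↑ʳ d) (b ↑ˡ k) ≡ 0ℚ
diagWithI-↑ʳ-↑ˡ {m} k A d b rewrite FinP.splitAt-↑ʳ m k d | FinP.splitAt-↑ˡ m b k = refl

diagWithI-entry : ∀ {m} k (A : Matrix m) i j →
  (∃₂ λ a b → diagWithI k A i j ≡ A a b) ⊎ IsIntegral (diagWithI k A i j)
diagWithI-entry {m} k A i j with splitAt m i | splitAt m j
... | inj₁ a | inj₁ b = inj₁ (a , b , refl)
... | inj₁ _ | inj₂ _ = inj₂ refl
... | inj₂ _ | inj₁ _ = inj₂ refl
... | inj₂ a | inj₂ b = inj₂ (I-integral k a b)

regular-reindex : ∀ {m n} (Q : Matrix n) → Regular Q → (σ τ : Fin m ↔ Fin n) →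
  Regular (λ i j → Q (Inverse.to σ i) (Inverse.to τ j))
regular-reindex Q Q-regular σ τ i = trans (Σ-permute τ (Q (Inverse.to σ i))) (Q-regular _)

orthogonal-reindex : ∀ {m n} (Q : Matrix n) → Orthogonal Q → (σ τ : Fin m ↔ Fin n) →
  Orthogonal (λ i j → Q (Inverse.to σ i) (Inverse.to τ j))
orthogonal-reindex Q Q-orthogonal σ τ i j =
  trans (Σ-permute σ (λ r → Q r (Inverse.to τ i) * Q r (Inverse.to τ j)))
        (trans (Q-orthogonal _ _) (I-reindex (Injection.injective (↔⇒↣ τ)) i j))

regular-topLeft : ∀ {m} k {A : Matrix m} → Regular (diagWithI k A) → Regular A
regular-topLeft {m} k {A} D-regular a = begin
  Σℚ m (A a)                                      ≡⟨ Σ-cong (sym ∘ diagWithI-↑ˡ-↑ˡ k A a) ⟩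
  Σℚ m (λ b → diagWithI k A (a ↑ˡ k) (b ↑ˡ k))    ≡⟨ Σ-↑ˡ m (diagWithI-↑ˡ-↑ʳ k A a) ⟨
  Σℚ (m + k) (diagWithI k A (a ↑ˡ k))             ≡⟨ D-regular (a ↑ˡ k) ⟩
  1ℚ                                              ∎
  where open ≡-Reasoning

orthogonal-topLeft : ∀ {m} k {A : Matrix m} → Orthogonal (diagWithI k A) → Orthogonal A
orthogonal-topLeft {m} k {A} D-orthogonal a b = begin
  Σℚ m (λ c → A c a * A c b)
    ≡⟨ Σ-cong (λ c → sym (cong₂ _*_ (diagWithI-↑ˡ-↑ˡ k A c a) (diagWithI-↑ˡ-↑ˡ k A c b))) ⟩
  Σℚ m (λ c → D (c ↑ˡ k) (a ↑ˡ k) * D (c ↑ˡ k) (b ↑ˡ k))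
    ≡⟨ Σ-↑ˡ m lower-rows≡0 ⟨
  Σℚ (m + k) (λ c → D c (a ↑ˡ k) * D c (b ↑ˡ k))  ≡⟨ D-orthogonal (a ↑ˡ k) (b ↑ˡ k) ⟩
  I (m + k) (a ↑ˡ k) (b ↑ˡ k)                     ≡⟨ I-reindex (FinP.↑ˡ-injective k _ _) a b ⟩
  I m a b                                         ∎
  where
  open ≡-Reasoning
  D : Matrix (m + k)
  D = diagWithI k A
  lower-rows≡0 : ∀ d → D (m ↑ʳ d) (a ↑ˡ k) * D (m ↑ʳ d) (b ↑ˡ k) ≡ 0ℚ
  lower-rows≡0 d = trans (cong (_* D (m ↑ʳ d) (b ↑ˡ k)) (diagWithI-↑ʳ-↑ˡ k A d a))
                         (ℚP.*-zeroˡ (D (m ↑ʳ d) (b ↑ˡ k)))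

Nonintegral : ∀ {m} → Matrix m → Set
Nonintegral A = ∀ a b → ¬ IsIntegral (A a b)

record QuasiDiagonalForm {n} (Q : Matrix n) : Set where
  field
    m k    : ℕ
    σ τ    : Fin (m + k) ↔ Fin n
    Q₀     : Matrix m
    blocks : ∀ i j → Q (Inverse.to σ i) (Inverse.to τ j) ≡ diagWithI k Q₀ i j

module QuasiDiagonal {n} {Q : Matrix n} (F : QuasiDiagonalForm Q) where
  open QuasiDiagonalForm F public

  Q≡Q₀ : ∀ a b → Q (Inverse.to σ (a ↑ˡ k)) (Inverse.to τ (b ↑ˡ k)) ≡ Q₀ a b
  Q≡Q₀ a b = trans (blocks _ _) (diagWithI-↑ˡ-↑ˡ k Q₀ a b)

  Q≡diagWithI : ∀ i j → Q i j ≡ diagWithI k Q₀ (Inverse.from σ i) (Inverse.from τ j)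
  Q≡diagWithI i j =
    trans (sym (cong₂ Q (Inverse.strictlyInverseˡ σ i) (Inverse.strictlyInverseˡ τ j))) (blocks _ _)

  Q-entry : ∀ i j → (∃₂ λ a b → Q i j ≡ Q₀ a b) ⊎ IsIntegral (Q i j)
  Q-entry i j = Sum.map (λ (a , b , D≡Q₀) → a , b , trans (Q≡diagWithI i j) D≡Q₀)
                        (subst IsIntegral (sym (Q≡diagWithI i j)))
                        (diagWithI-entry k Q₀ (Inverse.from σ i) (Inverse.from τ j))

  nonintegral-entry : ∀ {i j} → ¬ IsIntegral (Q i j) → ∃₂ λ a b → ¬ IsIntegral (Q₀ a b)
  nonintegral-entry {i} {j} Qij-nonintegral with Q-entry i j
  ... | inj₁ (a , b , Q≡Q₀ab) = a , b , Qij-nonintegral ∘ subst IsIntegral (sym Q≡Q₀ab)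
  ... | inj₂ Qij-integral      = ⊥-elim (Qij-nonintegral Qij-integral)

  integral-scale-Q₀⇒Q : ∀ c → IntegralMatrix (scale c Q₀) → IntegralMatrix (scale c Q)
  integral-scale-Q₀⇒Q c cQ₀-integral i j with Q-entry i j
  ... | inj₁ (a , b , Q≡Q₀ab) = subst (IsIntegral ∘ (ℕ→ℚ c *_)) (sym Q≡Q₀ab) (cQ₀-integral a b)
  ... | inj₂ Qij-integral      = integral-scale c Qij-integral

  regular-Q₀ : Regular Q → Regular Q₀
  regular-Q₀ Q-regular = regular-topLeft k λ i →
    trans (Σ-cong (sym ∘ blocks i)) (regular-reindex Q Q-regular σ τ i)

  orthogonal-Q₀ : Orthogonal Q → Orthogonal Q₀
  orthogonal-Q₀ Q-orthogonal = orthogonal-topLeft k λ i j →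
    trans (Σ-cong (λ r → sym (cong₂ _*_ (blocks r i) (blocks r j))))
          (orthogonal-reindex Q Q-orthogonal σ τ i j)

  primitive-Q₀ : ∀ {p} → Primitive p Q → (∃₂ λ a b → ¬ IsIntegral (Q₀ a b)) → Primitive p Q₀
  primitive-Q₀ {p}
    (Q-regular , Q-orthogonal , (1≤p , pQ-integral , p-minimal) , (_ , u , v , pQ≡uvᵀ))
    (a₁ , b₁ , Q₀a₁b₁-nonintegral) =
    regular-Q₀ Q-regular , orthogonal-Q₀ Q-orthogonal ,
    (1≤p , pQ₀-integral , λ c 1≤c → p-minimal c 1≤c ∘ integral-scale-Q₀⇒Q c) ,
    ((a₁ , b₁ , Q₀a₁b₁-nonintegral ∘ ∣↥-scale⇒integral (ℕP.m<n⇒n≢0 1≤p) (pQ₀-integral a₁ b₁)) ,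
     u ∘ row , v ∘ column , pQ₀≡uvᵀ)
    where
    row column : Fin m → Fin n
    row a    = Inverse.to σ (a ↑ˡ k)
    column b = Inverse.to τ (b ↑ˡ k)
    pQ₀-integral : IntegralMatrix (scale p Q₀)
    pQ₀-integral a b = subst (IsIntegral ∘ (ℕ→ℚ p *_)) (Q≡Q₀ a b) (pQ-integral _ _)
    pQ₀≡uvᵀ : ∀ a b → + p ∣ intMatrix (scale p Q₀) a b ℤ.- u (row a) ℤ.* v (column b)
    pQ₀≡uvᵀ a b = subst (λ x → + p ∣ ↥ (ℕ→ℚ p * x) ℤ.- u (row a) ℤ.* v (column b))
                        (Q≡Q₀ a b) (pQ≡uvᵀ _ _)

column-nonzero : ∀ {n} (Q : Matrix n) → Orthogonal Q → ∀ j → ∃ λ r → Q r j ≢ 0ℚ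
column-nonzero {n} Q Q-orthogonal j =
  let r , Qrj²≢0 = Σ≢0⇒∃≢0 (λ r → Q r j * Q r j) Σ≢0 in r , Qrj²≢0 ∘ cong (λ x → x * x)
  where
  Σ≢0 : Σℚ n (λ r → Q r j * Q r j) ≢ 0ℚ
  Σ≢0 Σ≡0 = ℚP.1≢0 (trans (sym (trans (Q-orthogonal j j) (I-diag n j))) Σ≡0)

row-nonzero : ∀ {n} (Q : Matrix n) → Regular Q → ∀ i → ∃ λ j → Q i j ≢ 0ℚ
row-nonzero Q Q-regular i = Σ≢0⇒∃≢0 (Q i) (λ Σ≡0 → ℚP.1≢0 (trans (sym (Q-regular i)) Σ≡0))

integral-entry-isolates-column : ∀ {n} (Q : Matrix n) → Orthogonal Q → ∀ {r j} →
  IsIntegral (Q r j) → Q r j ≢ 0ℚ → ∀ k → k ≢ r → Q k j ≡ 0ℚ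
integral-entry-isolates-column {n} Q Q-orthogonal {r} {j} Qrj-integral Qrj≢0 k k≢r =
  x*x≡0⇒x≡0 (Q k j) (nonneg-Σ≡1⇒others≡0 (λ l → 0≤x*x (Q l j))
    (trans (Q-orthogonal j j) (I-diag n j)) (1≤x*x Qrj-integral Qrj≢0) k k≢r)

isolated-column-entry-isolates-row : ∀ {n} (Q : Matrix n) → Orthogonal Q → ∀ {r j} → Q r j ≢ 0ℚ →
  (∀ k → k ≢ r → Q k j ≡ 0ℚ) → ∀ l → l ≢ j → Q r l ≡ 0ℚ
isolated-column-entry-isolates-row {n} Q Q-orthogonal {r} {j} Qrj≢0 column-isolated l l≢j =
  Sum.[ id , ⊥-elim ∘ Qrj≢0 ] (x*y≡0⇒x≡0∨y≡0 (Q r l) (Q r j) (begin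
    Q r l * Q r j                   ≡⟨ Σ-single r Qkl*Qkj≡0 ⟨
    Σℚ n (λ k → Q k l * Q k j)      ≡⟨ Q-orthogonal l j ⟩
    I n l j                         ≡⟨ I-off n l≢j ⟩
    0ℚ                              ∎))
  where
  open ≡-Reasoning
  Qkl*Qkj≡0 : ∀ k → k ≢ r → Q k l * Q k j ≡ 0ℚ
  Qkl*Qkj≡0 k k≢r = trans (cong (Q k l *_) (column-isolated k k≢r)) (ℚP.*-zeroʳ (Q k l))

isolated-row-entry≡1 : ∀ {n} (Q : Matrix n) → Regular Q → ∀ {r j} →
  (∀ l → l ≢ j → Q r l ≡ 0ℚ) → Q r j ≡ 1ℚ
isolated-row-entry≡1 Q Q-regular {r} {j} row-isolated =
  trans (sym (Σ-single j row-isolated)) (Q-regular r)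

record Enumerates {m n} (P : Fin n → Set) (f : Fin m → Fin n) : Set where
  field
    injective : Injective _≡_ _≡_ f
    sound     : ∀ a → P (f a)
    complete  : ∀ {i} → P i → ∃ λ a → f a ≡ i

open Enumerates

Enumerates-suc : ∀ {m n} {P : Fin (suc n) → Set} {f : Fin m → Fin n} →
  Enumerates (P ∘ suc) f → ¬ P zero → Enumerates P (suc ∘ f)
Enumerates-suc ef ¬P0 .injective = injective ef ∘ FinP.suc-injective
Enumerates-suc ef ¬P0 .sound     = sound ef
Enumerates-suc ef ¬P0 .complete {zero}  P0  = ⊥-elim (¬P0 P0)
Enumerates-suc ef ¬P0 .complete {suc i} Psi = Prod.map₂ (cong suc) (complete ef Psi)

Enumerates-cons : ∀ {m n} {P : Fin (suc n) → Set} {f : Fin m → Fin n} →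
  Enumerates (P ∘ suc) f → P zero → Enumerates P (zero ∷ suc ∘ f)
Enumerates-cons ef P0 .injective {zero}  {zero}  _  = refl
Enumerates-cons ef P0 .injective {suc a} {suc b} eq =
  cong suc (injective ef (FinP.suc-injective eq))
Enumerates-cons ef P0 .sound zero    = P0
Enumerates-cons ef P0 .sound (suc a) = sound ef a
Enumerates-cons ef P0 .complete {zero}  _   = zero , refl
Enumerates-cons ef P0 .complete {suc i} Psi = Prod.map suc (cong suc) (complete ef Psi)

enumerate : ∀ {n} {P : Fin n → Set} → Decidable P → ∃ λ m → Σ (Fin m → Fin n) (Enumerates P)
enumerate {zero} P? = 0 , (λ ()) , λ where
  .injective {()}
  .sound ()
  .complete {()}
enumerate {suc n} P? with enumerate (P? ∘ suc) | P? zero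
... | m , f , ef | yes P0 = suc m , zero ∷ suc ∘ f , Enumerates-cons ef P0
... | m , f , ef | no ¬P0 = m , suc ∘ f , Enumerates-suc ef ¬P0

enumerations⇒↔ : ∀ {m k n} {P : Fin n → Set} {f : Fin m → Fin n} {g : Fin k → Fin n} →
  Decidable P → Enumerates P f → Enumerates (∁ P) g → (Fin m ⊎ Fin k) ↔ Fin n
enumerations⇒↔ {P = P} {f} {g} P? ef eg = ⤖⇒↔ (mk⤖ ([f,g]-injective , [f,g]-surjective))
  where
  [f,g]-injective : Injective _≡_ _≡_ [ f , g ]′
  [f,g]-injective {inj₁ a} {inj₁ b} eq = cong inj₁ (injective ef eq)
  [f,g]-injective {inj₁ a} {inj₂ b} eq = ⊥-elim (sound eg b (subst P eq (sound ef a)))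
  [f,g]-injective {inj₂ a} {inj₁ b} eq = ⊥-elim (sound eg a (subst P (sym eq) (sound ef b)))
  [f,g]-injective {inj₂ a} {inj₂ b} eq = cong inj₂ (injective eg eq)
  [f,g]-surjective : Surjective _≡_ _≡_ [ f , g ]′
  [f,g]-surjective i with P? i
  ... | yes Pi = let a , fa≡i = complete ef Pi in inj₁ a , λ { refl → fa≡i }
  ... | no ¬Pi = let b , gb≡i = complete eg ¬Pi in inj₂ b , λ { refl → gb≡i }

enumerations⇒+≡ : ∀ {m k n} {P : Fin n → Set} {f : Fin m → Fin n} {g : Fin k → Fin n} →
  Decidable P → Enumerates P f → Enumerates (∁ P) g → m + k ≡ n
enumerations⇒+≡ P? ef eg = ↔⇒≡ (enumerations⇒↔ P? ef eg ↔-∘ FinP.+↔⊎)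

module IntegralityRectangle
  {n} {Q : Matrix n} (Q-regular : Regular Q) (Q-orthogonal : Orthogonal Q)
  {R C : Fin n → Set} (R? : Decidable R) (C? : Decidable C)
  (nonintegral⇒R×C : ∀ {i j} → ¬ IsIntegral (Q i j) → R i × C j)
  (R×C⇒nonintegral : ∀ {i j} → R i → C j → ¬ IsIntegral (Q i j))
  {i₁ j₁} (Qi₁j₁-nonintegral : ¬ IsIntegral (Q i₁ j₁))
  where

  R-i₁ : R i₁
  R-i₁ = proj₁ (nonintegral⇒R×C Qi₁j₁-nonintegral)

  C-j₁ : C j₁
  C-j₁ = proj₂ (nonintegral⇒R×C Qi₁j₁-nonintegral)

  ¬R⇒integral : ∀ {i} j → ¬ R i → IsIntegral (Q i j)
  ¬R⇒integral {i} j ¬Ri =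
    decidable-stable (isIntegral? (Q i j)) (¬Ri ∘ proj₁ ∘ nonintegral⇒R×C {i} {j})

  ¬C⇒integral : ∀ i {j} → ¬ C j → IsIntegral (Q i j)
  ¬C⇒integral i {j} ¬Cj =
    decidable-stable (isIntegral? (Q i j)) (¬Cj ∘ proj₂ ∘ nonintegral⇒R×C {i} {j})

  ¬R×C⇒≡0 : ∀ {i j} → ¬ R i → C j → Q i j ≡ 0ℚ
  ¬R×C⇒≡0 {i} {j} ¬Ri Cj = decidable-stable (Q i j ℚP.≟ 0ℚ) λ Qij≢0 →
    R×C⇒nonintegral R-i₁ Cj (subst IsIntegral (sym (integral-entry-isolates-column Q Q-orthogonal
      (¬R⇒integral j ¬Ri) Qij≢0 i₁ (λ i₁≡i → ¬Ri (subst R i₁≡i R-i₁)))) refl)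

  pivot : Fin n → Fin n
  pivot j = proj₁ (column-nonzero Q Q-orthogonal j)

  pivot≢0 : ∀ j → Q (pivot j) j ≢ 0ℚ
  pivot≢0 j = proj₂ (column-nonzero Q Q-orthogonal j)

  module _ {j} (¬Cj : ¬ C j) where

    column-isolated : ∀ k → k ≢ pivot j → Q k j ≡ 0ℚ
    column-isolated = integral-entry-isolates-column Q Q-orthogonal (¬C⇒integral _ ¬Cj) (pivot≢0 j)

    row-isolated : ∀ l → l ≢ j → Q (pivot j) l ≡ 0ℚ
    row-isolated = isolated-column-entry-isolates-row Q Q-orthogonal (pivot≢0 j) column-isolated

    pivot≡1 : Q (pivot j) j ≡ 1ℚ
    pivot≡1 = isolated-row-entry≡1 Q Q-regular row-isolated

    ¬R-pivot : ¬ R (pivot j)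
    ¬R-pivot R-pivot = R×C⇒nonintegral R-pivot C-j₁
      (subst IsIntegral (sym (row-isolated j₁ (λ j₁≡j → ¬Cj (subst C j₁≡j C-j₁)))) refl)

  R×¬C⇒≡0 : ∀ {i j} → R i → ¬ C j → Q i j ≡ 0ℚ
  R×¬C⇒≡0 Ri ¬Cj = column-isolated ¬Cj _ (λ i≡pivot → ¬R-pivot ¬Cj (subst R i≡pivot Ri))

  pivot-injective : ∀ {j l} → ¬ C j → ¬ C l → pivot j ≡ pivot l → j ≡ l
  pivot-injective {j} {l} ¬Cj ¬Cl pivot-j≡pivot-l = decidable-stable (j FinP.≟ l) λ j≢l →
    pivot≢0 j (trans (cong (λ r → Q r j) pivot-j≡pivot-l) (row-isolated ¬Cl j j≢l))

  ¬R⇒pivot : ∀ {i} → ¬ R i → ∃ λ j → ¬ C j × pivot j ≡ i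
  ¬R⇒pivot {i} ¬Ri = j , ¬Cj , decidable-stable (pivot j FinP.≟ i) λ pivot≢i →
      Qij≢0 (column-isolated ¬Cj i (pivot≢i ∘ sym))
    where
    j = proj₁ (row-nonzero Q Q-regular i)
    Qij≢0 = proj₂ (row-nonzero Q Q-regular i)
    ¬Cj : ¬ C j
    ¬Cj Cj = Qij≢0 (¬R×C⇒≡0 ¬Ri Cj)

  module _ {k} {g : Fin k → Fin n} (eg : Enumerates (∁ C) g) where

    pivot-enumerates : Enumerates (∁ R) (pivot ∘ g)
    pivot-enumerates .injective eq = injective eg (pivot-injective (sound eg _) (sound eg _) eq)
    pivot-enumerates .sound b = ¬R-pivot (sound eg b)
    pivot-enumerates .complete ¬Ri =
      let j , ¬Cj , pivot-j≡i = ¬R⇒pivot ¬Ri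
          b , gb≡j = complete eg ¬Cj
      in b , trans (cong pivot gb≡j) pivot-j≡i

    pivot-block : ∀ a b → Q (pivot (g a)) (g b) ≡ I k a b
    pivot-block a b with a FinP.≟ b
    ... | yes refl = pivot≡1 (sound eg a)
    ... | no  a≢b  = row-isolated (sound eg a) (g b) (a≢b ∘ sym ∘ injective eg)

    enumerations⇒quasiDiagonalForm : ∀ {m} {f h : Fin m → Fin n} → Enumerates R f → Enumerates C h →
      Σ (QuasiDiagonalForm Q) (Nonintegral ∘ QuasiDiagonalForm.Q₀)
    enumerations⇒quasiDiagonalForm {m} {f} {h} ef eh =
      F , λ a b → R×C⇒nonintegral (sound ef a) (sound eh b)
      where
      F : QuasiDiagonalForm Q
      F = record
        { m = m ; k = k
        ; σ = enumerations⇒↔ R? ef pivot-enumerates ↔-∘ FinP.+↔⊎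
        ; τ = enumerations⇒↔ C? eh eg ↔-∘ FinP.+↔⊎
        ; Q₀ = λ a b → Q (f a) (h b)
        ; blocks = diagWithI-blocks k (λ x y → Q ([ f , pivot ∘ g ]′ x) ([ h , g ]′ y))
            (λ _ _ → refl)
            (λ a b → R×¬C⇒≡0 (sound ef a) (sound eg b))
            (λ a b → ¬R×C⇒≡0 (¬R-pivot (sound eg a)) (sound eh b))
            pivot-block
        }

  -- |R| = |C|, because the pivots of the integral columns enumerate the integral rows
  quasiDiagonalForm : Σ (QuasiDiagonalForm Q) (Nonintegral ∘ QuasiDiagonalForm.Q₀)
  quasiDiagonalForm with enumerate R? | enumerate C? | enumerate (∁? C?)
  ... | m′ , f , ef | m , h , eh | k , g , eg
    with ℕP.+-cancelʳ-≡ k m′ m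
           (trans (enumerations⇒+≡ R? ef (pivot-enumerates eg)) (sym (enumerations⇒+≡ C? eh eg)))
  ... | refl = enumerations⇒quasiDiagonalForm eg ef eh

module _ {p n} {Q : Matrix n} {u v : Fin n → ℤ}
  (pQ≡uvᵀ : ∀ i j → + p ∣ intMatrix (scale p Q) i j ℤ.- u i ℤ.* v j) where

  nonintegral⇒p∤u×p∤v : p ≢ 0 → IntegralMatrix (scale p Q) →
    ∀ {i j} → ¬ IsIntegral (Q i j) → ¬ + p ∣ u i × ¬ + p ∣ v j
  nonintegral⇒p∤u×p∤v p≢0 pQ-integral {i} {j} Qij-nonintegral =
    Qij-nonintegral ∘ integral ∘ ∣m⇒∣m*n {+ p} (u i) (v j) ,
    Qij-nonintegral ∘ integral ∘ ∣n⇒∣m*n {+ p} (u i) (v j)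
    where
    integral : + p ∣ u i ℤ.* v j → IsIntegral (Q i j)
    integral p∣uv = ∣↥-scale⇒integral p≢0 (pQ-integral i j)
      (∣m-n∣n⇒∣m {+ p} {intMatrix (scale p Q) i j} (pQ≡uvᵀ i j) p∣uv)

  p∤u×p∤v⇒nonintegral : Prime p → ∀ {i j} → ¬ + p ∣ u i → ¬ + p ∣ v j → ¬ IsIntegral (Q i j)
  p∤u×p∤v⇒nonintegral p-prime {i} {j} p∤ui p∤vj Qij-integral = Sum.[ p∤ui , p∤vj ]
    (euclidsLemmaℤ (u i) (v j) p-prime
      (∣m-n∣m⇒∣n {+ p} {intMatrix (scale p Q) i j} (pQ≡uvᵀ i j) (integral⇒∣↥-scale p Qij-integral)))

primitive⇒quasiDiagonalForm : ∀ {p n} {Q : Matrix n} → Prime p → Primitive p Q →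
  ∀ {i₁ j₁} → ¬ IsIntegral (Q i₁ j₁) → Σ (QuasiDiagonalForm Q) (Nonintegral ∘ QuasiDiagonalForm.Q₀)
primitive⇒quasiDiagonalForm {p} {Q = Q} p-prime
  (Q-regular , Q-orthogonal , (1≤p , pQ-integral , _) , (_ , u , v , pQ≡uvᵀ)) =
  IntegralityRectangle.quasiDiagonalForm Q-regular Q-orthogonal (p∤? ∘ u) (p∤? ∘ v)
    (nonintegral⇒p∤u×p∤v {u = u} {v} pQ≡uvᵀ (ℕP.m<n⇒n≢0 1≤p) pQ-integral)
    (p∤u×p∤v⇒nonintegral {u = u} {v} pQ≡uvᵀ p-prime)
  where
  p∤? : Decidable (λ z → ¬ + p ∣ z)
  p∤? z = ¬? (p ℕD.∣? ℤ.∣ z ∣)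

lemma2p9 : (p n : ℕ) → OddPrime p → (Q : Matrix n) → Primitive p Q →
    (∃ λ i → ∃ λ j → ¬ IsIntegral (Q i j)) →
    Σ ℕ λ m → Σ ℕ λ k → Σ (Fin (m + k) ↔ Fin n) λ σ → Σ (Fin (m + k) ↔ Fin n) λ τ →
    Σ (Matrix m) λ Q₀ →
    Primitive p Q₀ × (∀ a b → ¬ IsIntegral (Q₀ a b)) ×
    (∀ i j → Q (Inverse.to σ i) (Inverse.to τ j) ≡ diagWithI k Q₀ i j)
lemma2p9 p n (p-prime , _) Q Q-primitive (i₁ , j₁ , Qi₁j₁-nonintegral) =
  let F , Q₀-nonintegral = primitive⇒quasiDiagonalForm p-prime Q-primitive Qi₁j₁-nonintegral
      open QuasiDiagonal F
  in  m , k , σ , τ , Q₀ ,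
      primitive-Q₀ Q-primitive (nonintegral-entry Qi₁j₁-nonintegral) , Q₀-nonintegral , blocks
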